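{- Let $G$ be a connected graph with root vertex $r$, and let $\phi$ be an atomic edge-coloring of $G$ that is a strong parity edge-coloring. For $x\in\mathbb{U}$ let $[x]=x+S_r$ denote its coset in the quotient space $\mathbb{U}/S_r$, and let $\pi(x)=[x]$. Then the edge-coloring $\phi^*$ assigning to each edge $uv$ the coset $[\phi(uv)]$ is a canonical edge-coloring of $G$ (with colors in the $\mathbb{F}_2$-vector space $\mathbb{U}/S_r$); moreover $\phi^*=\pi\circ\phi$, and $\phi^*$ uses no more colors than $\phi$.
   Context: $\mathbb{U}$ is the vector space over $\mathbb{F}_2$ of binary sequences with finitely many $1$s. An atom is a vector of $\mathbb{U}$ with exactly one coordinate equal to $1$; an atomic edge-coloring assigns an atom to each edge. For a walk $W$ with edges $e_1,\dots,e_t$ in order, $\phi(W)=\phi(e_1)+\cdots+\phi(e_t)$. For $v\in V(G)$, $S_v=\{\phi(W): W \text{ a walk from } r \text{ to } v\}$; when $\phi$ is a strong parity edge-coloring, $S_r$ is a linear subspace of $\mathbb{U}$. A walk is a parity walk if each color appears an even number of times along it (with multiplicity), and open if its endpoints are distinct; a strong parity edge-coloring is an edge-coloring with no open parity walk. A binary labeling of $G$ is an injective map $f\colon V(G)\to\mathbb{V}$ into an $\mathbb{F}_2$-vector space $\mathbb{V}$; a canonical edge-coloring is one of the form $uv\mapsto f(u)+f(v)$ for some binary labeling $f$. -}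

module Defs where

open import Data.Nat using (ℕ; zero; suc; _≟_)
open import Data.Nat.Divisibility using (_∣_)
open import Data.Bool using (Bool; true; false; _xor_)
open import Data.Fin using (Fin)
open import Data.List using (List; []; _∷_; length; filter; map; foldr)
open import Data.List.Membership.Propositional using (_∈_)
open import Data.Product using (Σ; ∃; _×_; _,_)
open import Relation.Binary.PropositionalEquality using (_≡_)
open import Data.Empty using (⊥)
open import Relation.Nullary using (¬_)

-- The space 𝕌 of binary sequences with finitely many 1s.
-- An element is represented by a finite list of bits (a finite prefix);
-- all coordinates beyond the list are 0.  Two representations are equal
-- as vectors iff they agree at every coordinate.

U : Set
U = List Bool

coord : U → ℕ → Bool
coord []       _       = false
coord (b ∷ _)  zero    = b
coord (_ ∷ bs) (suc i) = coord bs i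

_≈U_ : U → U → Set
x ≈U y = ∀ i → coord x i ≡ coord y i

infixl 6 _⊕_
_⊕_ : U → U → U
[]       ⊕ ys       = ys
(x ∷ xs) ⊕ []       = x ∷ xs
(x ∷ xs) ⊕ (y ∷ ys) = (x xor y) ∷ (xs ⊕ ys)

𝟘 : U
𝟘 = []

atom : ℕ → U
atom zero    = true ∷ []
atom (suc i) = false ∷ atom i

record Graph (n : ℕ) : Set where
  field
    adj      : Fin n → Fin n → Bool
    adj-sym  : ∀ u v → adj u v ≡ adj v u
    adj-irr  : ∀ v → adj v v ≡ false
open Graph public

data Walk {n : ℕ} (G : Graph n) : Fin n → Fin n → Set where
  nil  : ∀ {v} → Walk G v v
  cons : ∀ {u w v} → adj G u w ≡ true → Walk G w v → Walk G u v

Connected : ∀ {n} → Graph n → Set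
Connected {n} G = (u v : Fin n) → Walk G u v

-- Atomic edge-colorings.  The atom assigned to edge uv is  atom (φ u v);
-- φ only matters on edges and must not depend on the orientation.

IsEdgeColoring : ∀ {n} → Graph n → (Fin n → Fin n → ℕ) → Set
IsEdgeColoring {n} G φ = ∀ (u v : Fin n) → adj G u v ≡ true → φ u v ≡ φ v u

colors : ∀ {n} {G : Graph n} → (Fin n → Fin n → ℕ) → ∀ {u v} → Walk G u v → List ℕ
colors φ nil = []
colors φ (cons {u} {w} _ W) = φ u w ∷ colors φ W

walkSum : ∀ {n} {G : Graph n} → (Fin n → Fin n → ℕ) → ∀ {u v} → Walk G u v → U
walkSum φ W = foldr _⊕_ 𝟘 (map atom (colors φ W))

occ : ∀ {n} {G : Graph n} → (Fin n → Fin n → ℕ) → ∀ {u v} → Walk G u v → ℕ → ℕ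
occ φ W c = length (filter (c ≟_) (colors φ W))

IsParityWalk : ∀ {n} {G : Graph n} → (Fin n → Fin n → ℕ) → ∀ {u v} → Walk G u v → Set
IsParityWalk φ W = ∀ c → 2 ∣ occ φ W c

IsStrongParity : ∀ {n} → (G : Graph n) → (Fin n → Fin n → ℕ) → Set
IsStrongParity {n} G φ = ∀ (u v : Fin n) (W : Walk G u v) → IsParityWalk φ W → u ≡ v

InS : ∀ {n} (G : Graph n) (φ : Fin n → Fin n → ℕ) (r : Fin n) → U → Set
InS G φ r x = Σ (Walk G r r) λ W → walkSum φ W ≈U x

-- Equality in the quotient 𝕌/S_r: [x] = [y]  iff  x + y ∈ S_r.
-- (Elements of 𝕌/S_r are represented by elements of 𝕌.)
SameCoset : ∀ {n} (G : Graph n) (φ : Fin n → Fin n → ℕ) (r : Fin n) → U → U → Set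
SameCoset G φ r x y = InS G φ r (x ⊕ y)

-- π(x) = [x]; represented by x itself, equality being SameCoset.
π : U → U
π x = x

φ* : ∀ {n} → (Fin n → Fin n → ℕ) → Fin n → Fin n → U
φ* φ u v = π (atom (φ u v))

IsCanonicalQuot : ∀ {n} (G : Graph n) (φ : Fin n → Fin n → ℕ) (r : Fin n) → Set
IsCanonicalQuot {n} G φ r =
  Σ (Fin n → U) λ f →
    (∀ u v → SameCoset G φ r (f u) (f v) → u ≡ v) ×
    (∀ u v → adj G u v ≡ true → SameCoset G φ r (φ* φ u v) (f u ⊕ f v))

UsesAtMost : ∀ {n} (G : Graph n) (φ : Fin n → Fin n → ℕ) (k : ℕ) → Set
UsesAtMost {n} G φ k =
  Σ (List ℕ) λ cs → length cs ≡ k ×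
    (∀ (u v : Fin n) → adj G u v ≡ true → φ u v ∈ cs)

UsesAtMostQuot : ∀ {n} (G : Graph n) (φ : Fin n → Fin n → ℕ) (r : Fin n) (k : ℕ) → Set
UsesAtMostQuot {n} G φ r k =
  Σ (List U) λ cs → length cs ≡ k ×
    (∀ (u v : Fin n) → adj G u v ≡ true →
       Σ U λ c → c ∈ cs × SameCoset G φ r (φ* φ u v) c)

-- Fix for every vertex v a walk P v from r and label v by f v = φ(P v).  For an
-- edge uv, the closed walk P u · uv · (P v)⁻¹ shows φ(uv) + f u + f v ∈ S_r,
-- since a walk and its reverse have the same sum.  If f u + f v ∈ S_r, witnessed
-- by a closed walk C at r, then (P u)⁻¹ · C · P v is a walk from u to v whose sum
-- is 0, i.e. a parity walk; strong parity forces u = v.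
module Submission where

open import Defs
open import Algebra.Bundles using (AbelianGroup)
open import Data.Bool using (true; false; not; _xor_)
open import Data.Bool.Properties using (xor-identityʳ; xor-assoc; xor-comm; xor-same; not-injective)
open import Data.Fin using (Fin)
open import Data.List using (List; []; _∷_; length; filter; map; foldr)
open import Data.List.Properties using (length-map)
open import Data.List.Membership.Propositional.Properties using (∈-map⁺)
open import Data.Nat using (ℕ; zero; suc; _≟_)
open import Data.Nat.Divisibility using (_∣_; _∣0; ∣-refl; ∣m∣n⇒∣m+n)
open import Data.Product using (_×_; _,_; proj₁)
open import Function using (id; _∘_)
open import Level using (0ℓ)
open import Relation.Nullary using (does)
open import Relation.Binary.PropositionalEquality using (_≡_; refl; sym; trans; cong)

coord-⊕ : ∀ x y i → coord (x ⊕ y) i ≡ coord x i xor coord y i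
coord-⊕ []       y        i       = refl
coord-⊕ (x ∷ xs) []       i       = sym (xor-identityʳ _)
coord-⊕ (x ∷ xs) (y ∷ ys) zero    = refl
coord-⊕ (x ∷ xs) (y ∷ ys) (suc i) = coord-⊕ xs ys i

coord-atom : ∀ j i → coord (atom j) i ≡ does (i ≟ j)
coord-atom zero    zero    = refl
coord-atom zero    (suc i) = refl
coord-atom (suc j) zero    = refl
coord-atom (suc j) (suc i) = coord-atom j i

-- x ≈U y unfolds to a Π-type in which x and y only occur under coord, so Agda
-- cannot infer them from a proof; hence the explicit implicit arguments.
⊕-cong : ∀ {x y u v} → x ≈U y → u ≈U v → (x ⊕ u) ≈U (y ⊕ v)
⊕-cong {x} {y} {u} {v} x≈y u≈v i
  rewrite coord-⊕ x u i | coord-⊕ y v i | x≈y i | u≈v i = refl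

⊕-congˡ : ∀ x {u v} → u ≈U v → (x ⊕ u) ≈U (x ⊕ v)
⊕-congˡ x {u} {v} u≈v = ⊕-cong {x} {x} {u} {v} (λ _ → refl) u≈v

⊕-assoc : ∀ x y z → ((x ⊕ y) ⊕ z) ≈U (x ⊕ (y ⊕ z))
⊕-assoc x y z i
  rewrite coord-⊕ (x ⊕ y) z i | coord-⊕ x y i | coord-⊕ x (y ⊕ z) i | coord-⊕ y z i
  = xor-assoc (coord x i) (coord y i) (coord z i)

⊕-comm : ∀ x y → (x ⊕ y) ≈U (y ⊕ x)
⊕-comm x y i rewrite coord-⊕ x y i | coord-⊕ y x i = xor-comm (coord x i) (coord y i)

⊕-identityʳ : ∀ x → (x ⊕ 𝟘) ≈U x
⊕-identityʳ x i rewrite coord-⊕ x 𝟘 i = xor-identityʳ (coord x i)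

⊕-self : ∀ x → (x ⊕ x) ≈U 𝟘
⊕-self x i rewrite coord-⊕ x x i = xor-same (coord x i)

⊕-abelianGroup : AbelianGroup 0ℓ 0ℓ
⊕-abelianGroup = record
  { Carrier        = U
  ; _≈_            = _≈U_
  ; _∙_            = _⊕_
  ; ε              = 𝟘
  ; _⁻¹            = id
  ; isAbelianGroup = record
    { isGroup = record
      { isMonoid = record
        { isSemigroup = record
          { isMagma = record
            { isEquivalence = record
              { refl  = λ _ → refl
              ; sym   = λ x≈y i → sym (x≈y i)
              ; trans = λ x≈y y≈z i → trans (x≈y i) (y≈z i)
              }
            ; ∙-cong = λ {x} {y} {u} {v} → ⊕-cong {x} {y} {u} {v}
            }
          ; assoc = ⊕-assoc
          }
        ; identity = (λ _ _ → refl) , ⊕-identityʳ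
        }
      ; inverse = ⊕-self , ⊕-self
      ; ⁻¹-cong = id
      }
    ; comm = ⊕-comm
    }
  }

open AbelianGroup ⊕-abelianGroup using (setoid; group; commutativeSemigroup)
open import Algebra.Properties.Group group using (x≈y⇒x∙y⁻¹≈ε)
open import Algebra.Properties.CommutativeSemigroup commutativeSemigroup using (x∙yz≈y∙xz)
open import Relation.Binary.Reasoning.Setoid setoid

sumAtoms : List ℕ → U
sumAtoms cs = foldr _⊕_ 𝟘 (map atom cs)

count : ℕ → List ℕ → ℕ
count c cs = length (filter (c ≟_) cs)

coord-sumAtoms-parity : ∀ c cs →
  (coord (sumAtoms cs) c ≡ false → 2 ∣ count c cs) ×
  (coord (sumAtoms cs) c ≡ true → 2 ∣ suc (count c cs))
coord-sumAtoms-parity c [] = (λ _ → 2 ∣0) , λ ()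
coord-sumAtoms-parity c (d ∷ ds)
  rewrite coord-⊕ (atom d) (sumAtoms ds) c | coord-atom d c
  with does (c ≟ d) | coord-sumAtoms-parity c ds
... | false | ih = ih
... | true  | even , odd = odd ∘ not-injective , ∣m∣n⇒∣m+n ∣-refl ∘ even ∘ not-injective

sumAtoms≈𝟘⇒evenCounts : ∀ cs → sumAtoms cs ≈U 𝟘 → ∀ c → 2 ∣ count c cs
sumAtoms≈𝟘⇒evenCounts cs s≈𝟘 c = proj₁ (coord-sumAtoms-parity c cs) (s≈𝟘 c)

module _ {n : ℕ} {G : Graph n} where

  infixr 5 _++ʷ_

  _++ʷ_ : ∀ {u v w} → Walk G u v → Walk G v w → Walk G u w
  nil       ++ʷ W′ = W′
  cons e W  ++ʷ W′ = cons e (W ++ʷ W′)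

  reverseʷ : ∀ {u v} → Walk G u v → Walk G v u
  reverseʷ nil                = nil
  reverseʷ (cons {u} {w} e W) = reverseʷ W ++ʷ cons (trans (adj-sym G w u) e) nil

module _ {n : ℕ} {G : Graph n} (φ : Fin n → Fin n → ℕ) where

  walkSum-++ʷ : ∀ {u v w} (W : Walk G u v) (W′ : Walk G v w) →
                walkSum φ (W ++ʷ W′) ≈U (walkSum φ W ⊕ walkSum φ W′)
  walkSum-++ʷ nil                W′ = λ _ → refl
  walkSum-++ʷ (cons {u} {w} e W) W′ = begin
    atom (φ u w) ⊕ walkSum φ (W ++ʷ W′)            ≈⟨ ⊕-congˡ (atom (φ u w)) (walkSum-++ʷ W W′) ⟩
    atom (φ u w) ⊕ (walkSum φ W ⊕ walkSum φ W′)    ≈⟨ ⊕-assoc (atom (φ u w)) _ _ ⟨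
    (atom (φ u w) ⊕ walkSum φ W) ⊕ walkSum φ W′    ∎

  walkSum-reverseʷ : IsEdgeColoring G φ → ∀ {u v} (W : Walk G u v) →
                     walkSum φ (reverseʷ W) ≈U walkSum φ W
  walkSum-reverseʷ ec nil                = λ _ → refl
  walkSum-reverseʷ ec (cons {u} {w} e W) = begin
    walkSum φ (reverseʷ W ++ʷ cons _ nil)          ≈⟨ walkSum-++ʷ (reverseʷ W) _ ⟩
    walkSum φ (reverseʷ W) ⊕ (atom (φ w u) ⊕ 𝟘)    ≈⟨ ⊕-congˡ (walkSum φ (reverseʷ W)) (⊕-identityʳ (atom (φ w u))) ⟩
    walkSum φ (reverseʷ W) ⊕ atom (φ w u)          ≈⟨ ⊕-comm (walkSum φ (reverseʷ W)) _ ⟩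
    atom (φ w u) ⊕ walkSum φ (reverseʷ W)          ≈⟨ ⊕-congˡ (atom (φ w u)) (walkSum-reverseʷ ec W) ⟩
    atom (φ w u) ⊕ walkSum φ W                     ≡⟨ cong (λ c → atom c ⊕ walkSum φ W) (ec u w e) ⟨
    atom (φ u w) ⊕ walkSum φ W                     ∎

  walkSum≈𝟘⇒parityWalk : ∀ {u v} (W : Walk G u v) → walkSum φ W ≈U 𝟘 → IsParityWalk φ W
  walkSum≈𝟘⇒parityWalk W = sumAtoms≈𝟘⇒evenCounts (colors φ W)

module RootLabelling {n : ℕ} (G : Graph n) (r : Fin n) (φ : Fin n → Fin n → ℕ)
                     (ec : IsEdgeColoring G φ) (path : ∀ v → Walk G r v) where

  label : Fin n → U
  label v = walkSum φ (path v)

  label-injective : IsStrongParity G φ →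
                    ∀ u v → SameCoset G φ r (label u) (label v) → u ≡ v
  label-injective sp u v (C , C≈) = sp u v W (walkSum≈𝟘⇒parityWalk φ W W≈𝟘)
    where
    W : Walk G u v
    W = reverseʷ (path u) ++ʷ C ++ʷ path v

    W≈𝟘 : walkSum φ W ≈U 𝟘
    W≈𝟘 = begin
      walkSum φ W                                               ≈⟨ walkSum-++ʷ φ (reverseʷ (path u)) (C ++ʷ path v) ⟩
      walkSum φ (reverseʷ (path u)) ⊕ walkSum φ (C ++ʷ path v)  ≈⟨ ⊕-cong {walkSum φ (reverseʷ (path u))} {label u}
                                                                     (walkSum-reverseʷ φ ec (path u)) (walkSum-++ʷ φ C (path v)) ⟩
      label u ⊕ (walkSum φ C ⊕ label v)                         ≈⟨ x∙yz≈y∙xz (label u) (walkSum φ C) (label v) ⟩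
      walkSum φ C ⊕ (label u ⊕ label v)                         ≈⟨ x≈y⇒x∙y⁻¹≈ε {walkSum φ C} {label u ⊕ label v} C≈ ⟩
      𝟘                                                         ∎

  edge-sameCoset : ∀ u v → adj G u v ≡ true → SameCoset G φ r (φ* φ u v) (label u ⊕ label v)
  edge-sameCoset u v e = C , C≈
    where
    C : Walk G r r
    C = path u ++ʷ cons e (reverseʷ (path v))

    C≈ : walkSum φ C ≈U (atom (φ u v) ⊕ (label u ⊕ label v))
    C≈ = begin
      walkSum φ C                                               ≈⟨ walkSum-++ʷ φ (path u) (cons e (reverseʷ (path v))) ⟩
      label u ⊕ (atom (φ u v) ⊕ walkSum φ (reverseʷ (path v)))  ≈⟨ ⊕-congˡ (label u) (⊕-congˡ (atom (φ u v)) (walkSum-reverseʷ φ ec (path v))) ⟩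
      label u ⊕ (atom (φ u v) ⊕ label v)                        ≈⟨ x∙yz≈y∙xz (label u) (atom (φ u v)) (label v) ⟩
      atom (φ u v) ⊕ (label u ⊕ label v)                        ∎

sameCoset-refl : ∀ {n} (G : Graph n) φ r x → SameCoset G φ r x x
sameCoset-refl G φ r x = nil , λ i → sym (⊕-self x i)

usesAtMost⇒usesAtMostQuot : ∀ {n} (G : Graph n) φ r k → UsesAtMost G φ k → UsesAtMostQuot G φ r k
usesAtMost⇒usesAtMostQuot G φ r k (cs , |cs|≡k , cs-covers) =
  map atom cs , trans (length-map atom cs) |cs|≡k ,
  λ u v e → atom (φ u v) , ∈-map⁺ atom (cs-covers u v e) , sameCoset-refl G φ r (atom (φ u v))

theorem2p7 : ∀ {n : ℕ} (G : Graph n) (r : Fin n) (φ : Fin n → Fin n → ℕ) →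
    Connected G → IsEdgeColoring G φ → IsStrongParity G φ →
    IsCanonicalQuot G φ r × (∀ (k : ℕ) → UsesAtMost G φ k → UsesAtMostQuot G φ r k)
theorem2p7 G r φ connected ec sp =
  (label , label-injective sp , edge-sameCoset) , usesAtMost⇒usesAtMostQuot G φ r
  where open RootLabelling G r φ ec (connected r)
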